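{- Let $\mathbf G$ be a finite abelian group, $N=|\mathbf G|$, $k$ a positive integer, $A\subseteq\mathbf G$ with $|A|=\alpha N>0$, and $D=A-A$. Then for any $(x_1,\dots,x_k)\in A^k-\Delta_k(A)$, writing $X=\{x_1,\dots,x_k\}$, $$\mathrm{cov}(D_X)\leqslant\frac1\alpha\log\frac{N}{|A_X|}+1$$ (the right-hand side being $+\infty$ if $A_X=\emptyset$).
   Context: $A^k-\Delta_k(A)=\{(a_1-a,\dots,a_k-a):a,a_1,\dots,a_k\in A\}$. For $S\subseteq\mathbf G$, $S_X=\bigcap_{i=1}^k(S+x_i)$. $\mathrm{cov}(S)=\min\{|Y|:Y\subseteq\mathbf G,\ S+Y=\mathbf G\}$. -}

module Defs where

open import Level using (0ℓ)
open import Data.Nat as ℕ using (ℕ; zero; suc; _∸_; NonZero)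
open import Data.Integer using (+_)
open import Data.Rational using (ℚ; 1ℚ; _/_) renaming (_+_ to _+ℚ_; _*_ to _*ℚ_; _≤_ to _≤ℚ_)
open import Data.Fin using (Fin)
open import Data.Fin.Properties using (any?; _≟_)
open import Data.Fin.Subset using (Subset; _∈_; _∩_; ⊤; ∣_∣)
open import Data.Fin.Subset.Properties using (_∈?_)
open import Data.Vec using (Vec; lookup; tabulate; foldr′; map)
open import Data.Product using (Σ; _×_; ∃)
open import Relation.Binary.PropositionalEquality using (_≡_)
open import Relation.Nullary.Decidable using (⌊_⌋; _×-dec_)
open import Algebra.Core using (Op₁; Op₂)
open import Algebra.Structures using (IsAbelianGroup)

record FinAbGroup (N : ℕ) : Set where
  field
    _+_ : Op₂ (Fin N)
    0#  : Fin N
    -_  : Op₁ (Fin N)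
    isAbelianGroup : IsAbelianGroup _≡_ _+_ 0# -_

module _ {N : ℕ} (G : FinAbGroup N) where
  open FinAbGroup G

  -- S + x = { s + x : s ∈ S } = { g : g - x ∈ S }
  shift : Subset N → Fin N → Subset N
  shift S x = tabulate λ g → lookup S (g + (- x))

  -- S_X = ⋂_{i=1}^k (S + x_i)
  inter : ∀ {k} → Subset N → Vec (Fin N) k → Subset N
  inter S xs = foldr′ _∩_ ⊤ (map (shift S) xs)

  diffSet : Subset N → Subset N
  diffSet A = tabulate λ g →
    ⌊ any? (λ a → any? (λ b → (a ∈? A) ×-dec ((b ∈? A) ×-dec (g ≟ (a + (- b)))))) ⌋

  InDiffDiag : ∀ {k} → Subset N → Vec (Fin N) k → Set
  InDiffDiag {k} A xs =
    Σ (Fin N) λ a → a ∈ A × Σ (Vec (Fin N) k) λ as →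
      ((i : Fin k) → lookup as i ∈ A) × ((i : Fin k) → lookup xs i ≡ lookup as i + (- a))

  Covers : Subset N → Subset N → Set
  Covers S Y = (g : Fin N) → Σ (Fin N) λ s → s ∈ S × Σ (Fin N) λ y → y ∈ Y × g ≡ s + y

  IsCov : Subset N → ℕ → Set
  IsCov S c = (Σ (Subset N) λ Y → Covers S Y × ∣ Y ∣ ≡ c) ×
              ((Y : Subset N) → Covers S Y → c ℕ.≤ ∣ Y ∣)

expTerm : ℚ → ℕ → ℚ
expTerm q zero    = 1ℚ
expTerm q (suc j) = (expTerm q j *ℚ q) *ℚ (+ 1 / suc j)

expPartial : ℚ → ℕ → ℚ
expPartial q zero    = 1ℚ
expPartial q (suc n) = expPartial q n +ℚ expTerm q (suc n)

-- For q ≥ 0 and num, den > 0:  q ≤ ln (num / den)  ⇔  exp q ≤ num/den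
--   ⇔  every partial sum of exp q is ≤ num/den  (the partial sums increase to exp q).
LeLn : ℚ → ℕ → ℕ → Set
LeLn q num den = (n : ℕ) → expPartial q n *ℚ (+ den / 1) ≤ℚ (+ num / 1)

-- c ≤ (1/α) log (N / m) + 1  with α = a / N, natural log, a, N, m > 0.
-- Equivalent to (c - 1) · a / N ≤ ln (N / m); for c = 0 both sides hold trivially,
-- so truncated subtraction is harmless.
CovBound : (c a N : ℕ) → .{{NonZero N}} → (m : ℕ) → Set
CovBound c a N m = LeLn (+ ((c ∸ 1) ℕ.* a) / N) N m

{-# OPTIONS --safe #-}
-- Write B = A_X and α = |A|/N. For b ∈ B and a ∈ A, (b − a) − xᵢ = (b − xᵢ) − a ∈ A − A for
-- every i, so B − A ⊆ D_X. Now choose translates greedily: if U is the set of points h with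
-- h + y ∉ A for every chosen y, double counting gives Σ_y |{h ∈ U : h + y ∈ A}| = |U||A|, so
-- some y covers at least α|U| new points, and after j steps |U| ≤ (1 − α)^j N. Whenever
-- |U| < |B|, every g has some h ∉ U with g + h ∈ B, which puts g in (B − A) + Y ⊆ D_X + Y.
-- Hence the c − 1 translates chosen before reaching cov(D_X) = c leave at least |B| points
-- uncovered: |B| ≤ (1 − α)^{c−1} N. The logarithm is encoded through the partial sums Eₙ of
-- the exponential series, so the claim reads Eₙ(α(c − 1)) |B| ≤ N for all n, and
-- (1 − α) Eₙ(x + α) ≤ Eₙ(x) takes the place of 1 − α ≤ e^{−α}.
module Submission where

open import Defs
open import Data.Nat.Base as ℕ using (ℕ; zero; suc)
import Data.Nat.Properties as ℕ
open import Data.Integer.Base using (+_)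
open import Data.Rational.Base using (_/_)
open import Data.Bool.Base using (Bool; true; false; _∧_; not)
import Data.Bool.Properties as Bool
open import Data.Empty using (⊥; ⊥-elim)
open import Data.Fin.Base using (Fin; zero; suc)
open import Data.Fin.Properties using (any?)
open import Data.Fin.Subset using (Subset; _∈_; _∪_; ⁅_⁆; ∣_∣; inside; outside) renaming (⊥ to ∅)
open import Data.Fin.Subset.Properties
  using (∣⊥∣≡0; ∣⁅x⁆∣≡1; x∈⁅x⁆; x∈p∪q⁺; x∈p∩q⁺; x∈p∩q⁻; ∈⊤; x∈p⇒∣p-x∣<∣p∣)
open import Data.List.Base using (allFin)
import Data.List.Extrema ℕ.≤-totalOrder as Extrema
open import Data.List.Membership.Propositional.Properties using (∈-allFin)
import Data.List.Relation.Unary.All as All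
open import Data.Vec.Base using (Vec; []; _∷_; lookup; tabulate)
open import Data.Vec.Properties using (lookup∘tabulate; []=⇒lookup; lookup⇒[]=)
open import Data.Product.Base using (Σ; ∃; _×_; _,_; proj₁; proj₂)
open import Data.Sum.Base using (inj₁; inj₂)
open import Function.Base using (_∘_)
open import Relation.Binary.PropositionalEquality
open import Relation.Nullary.Decidable using (Dec; yes; no; ⌊_⌋; dec-true; isYes≗does; _×-dec_)
open import Algebra.Bundles using (AbelianGroup)
open import Data.Fin.Permutation using (permutation)
open import Algebra.Properties.Semiring.Sum ℕ.+-*-semiring
  using (sum; ∑-comm; ∑-distrib-+; ∑-permute; sum-cong-≗; *-distribˡ-sum; *-distribʳ-sum)

module _ where
  import Data.Integer.Base as ℤ
  import Data.Integer.Properties as ℤ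
  open import Data.Integer.Solver using (module +-*-Solver)
  open import Data.Rational
  open import Data.Rational.Properties
  open import Data.Rational.Solver renaming (module +-*-Solver to ℚ-Solver)
  open import Data.Rational.Unnormalised.Base as ℚᵘ using (mkℚᵘ; *≡*)
  import Data.Rational.Unnormalised.Properties as ℚᵘ

  fromℕ : ℕ → ℚ
  fromℕ n = + n / 1

  private
    toℚᵘ-/ : ∀ n d → toℚᵘ (+ n / suc d) ℚᵘ.≃ mkℚᵘ (+ n) d
    toℚᵘ-/ n d = toℚᵘ-fromℚᵘ (mkℚᵘ (+ n) d)

  /-nonNeg : ∀ n d → 0ℚ ≤ + n / suc d
  /-nonNeg n d = nonNegative⁻¹ _ {{normalize-nonNeg n (suc d)}}

  0/s≡0ℚ : ∀ d → + 0 / suc d ≡ 0ℚ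
  0/s≡0ℚ d = toℚᵘ-injective (ℚᵘ.≃-trans (toℚᵘ-/ 0 d) (*≡* refl))

  +-distrib-/ : ∀ m n d → + (m ℕ.+ n) / suc d ≡ + m / suc d + + n / suc d
  +-distrib-/ m n d = toℚᵘ-injective (begin
    toℚᵘ (+ (m ℕ.+ n) / suc d)
      ≈⟨ toℚᵘ-/ (m ℕ.+ n) d ⟩
    mkℚᵘ (+ (m ℕ.+ n)) d
      ≈⟨ *≡* (trans (cong (ℤ._* (+ suc d ℤ.* + suc d)) (ℤ.pos-+ m n))
                    (solve 3 (λ x y s → (x :+ y) :* (s :* s) := (x :* s :+ y :* s) :* s) refl (+ m) (+ n) (+ suc d))) ⟩
    mkℚᵘ (+ m) d ℚᵘ.+ mkℚᵘ (+ n) d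
      ≈⟨ ℚᵘ.+-cong (toℚᵘ-/ m d) (toℚᵘ-/ n d) ⟨
    toℚᵘ (+ m / suc d) ℚᵘ.+ toℚᵘ (+ n / suc d)
      ≈⟨ toℚᵘ-homo-+ (+ m / suc d) (+ n / suc d) ⟨
    toℚᵘ (+ m / suc d + + n / suc d) ∎)
    where
    open ℚᵘ.≃-Reasoning
    open +-*-Solver

  fromℕ-homo-* : ∀ m n → fromℕ (m ℕ.* n) ≡ fromℕ m * fromℕ n
  fromℕ-homo-* m n = toℚᵘ-injective (begin
    toℚᵘ (fromℕ (m ℕ.* n))              ≈⟨ toℚᵘ-/ (m ℕ.* n) 0 ⟩
    mkℚᵘ (+ (m ℕ.* n)) 0                ≈⟨ *≡* (cong (ℤ._* + 1) (ℤ.pos-* m n)) ⟩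
    mkℚᵘ (+ m) 0 ℚᵘ.* mkℚᵘ (+ n) 0      ≈⟨ ℚᵘ.*-cong (toℚᵘ-/ m 0) (toℚᵘ-/ n 0) ⟨
    toℚᵘ (fromℕ m) ℚᵘ.* toℚᵘ (fromℕ n)  ≈⟨ toℚᵘ-homo-* (fromℕ m) (fromℕ n) ⟨
    toℚᵘ (fromℕ m * fromℕ n)            ∎)
    where open ℚᵘ.≃-Reasoning

  n/s*s≡n : ∀ n d → + n / suc d * fromℕ (suc d) ≡ fromℕ n
  n/s*s≡n n d = toℚᵘ-injective (begin
    toℚᵘ (+ n / suc d * fromℕ (suc d))
      ≈⟨ toℚᵘ-homo-* (+ n / suc d) (fromℕ (suc d)) ⟩
    toℚᵘ (+ n / suc d) ℚᵘ.* toℚᵘ (fromℕ (suc d))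
      ≈⟨ ℚᵘ.*-cong (toℚᵘ-/ n d) (toℚᵘ-/ (suc d) 0) ⟩
    mkℚᵘ (+ n) d ℚᵘ.* mkℚᵘ (+ suc d) 0
      ≈⟨ *≡* (solve 2 (λ x s → (x :* s) :* con (+ 1) := x :* (s :* con (+ 1))) refl (+ n) (+ suc d)) ⟩
    mkℚᵘ (+ n) 0
      ≈⟨ toℚᵘ-/ n 0 ⟨
    toℚᵘ (fromℕ n) ∎)
    where
    open ℚᵘ.≃-Reasoning
    open +-*-Solver

  fromℕ-mono-≤ : ∀ {m n} → m ℕ.≤ n → fromℕ m ≤ fromℕ n
  fromℕ-mono-≤ {m} {n} m≤n = toℚᵘ-cancel-≤ (begin
    toℚᵘ (fromℕ m) ≃⟨ toℚᵘ-/ m 0 ⟩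
    mkℚᵘ (+ m) 0   ≤⟨ ℚᵘ.*≤* (ℤ.*-monoʳ-≤-nonNeg (+ 1) (ℤ.+≤+ m≤n)) ⟩
    mkℚᵘ (+ n) 0   ≃⟨ toℚᵘ-/ n 0 ⟨
    toℚᵘ (fromℕ n) ∎)
    where open ℚᵘ.≤-Reasoning

  private
    *-nonNeg : ∀ {p q} → 0ℚ ≤ p → 0ℚ ≤ q → 0ℚ ≤ p * q
    *-nonNeg {p} {q} p≥0 q≥0 =
      nonNegative⁻¹ _ {{nonNeg*nonNeg⇒nonNeg p {{nonNegative p≥0}} q {{nonNegative q≥0}}}}

  expTerm-nonNeg : ∀ {q} → 0ℚ ≤ q → ∀ j → 0ℚ ≤ expTerm q j
  expTerm-nonNeg q≥0 zero    = /-nonNeg 1 0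
  expTerm-nonNeg q≥0 (suc j) = *-nonNeg (*-nonNeg (expTerm-nonNeg q≥0 j) q≥0) (/-nonNeg 1 j)

  expPartial-nonNeg : ∀ {q} → 0ℚ ≤ q → ∀ n → 0ℚ ≤ expPartial q n
  expPartial-nonNeg q≥0 zero    = /-nonNeg 1 0
  expPartial-nonNeg q≥0 (suc n) = +-mono-≤ (expPartial-nonNeg q≥0 n) (expTerm-nonNeg q≥0 (suc n))

  expTerm-suc : ∀ q j → expTerm q (suc j) * fromℕ (suc j) ≡ expTerm q j * q
  expTerm-suc q j = begin
    expTerm q j * q * (+ 1 / suc j) * fromℕ (suc j)   ≡⟨ *-assoc (expTerm q j * q) _ _ ⟩
    expTerm q j * q * (+ 1 / suc j * fromℕ (suc j))   ≡⟨ cong (expTerm q j * q *_) (n/s*s≡n 1 j) ⟩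
    expTerm q j * q * 1ℚ                              ≡⟨ *-identityʳ _ ⟩
    expTerm q j * q                                   ∎
    where open ≡-Reasoning

  expPartial-0ℚ : ∀ n → expPartial 0ℚ n ≡ 1ℚ
  expPartial-0ℚ zero    = refl
  expPartial-0ℚ (suc n) = begin
    expPartial 0ℚ n + expTerm 0ℚ n * 0ℚ * (+ 1 / suc n)
      ≡⟨ cong₂ (λ e t → e + t * (+ 1 / suc n)) (expPartial-0ℚ n) (*-zeroʳ (expTerm 0ℚ n)) ⟩
    1ℚ + 0ℚ * (+ 1 / suc n)
      ≡⟨ cong (_+_ 1ℚ) (*-zeroˡ (+ 1 / suc n)) ⟩
    1ℚ + 0ℚ
      ≡⟨ +-identityʳ 1ℚ ⟩
    1ℚ ∎
    where open ≡-Reasoning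

  module _ {x α : ℚ} (x≥0 : 0ℚ ≤ x) (α≥0 : 0ℚ ≤ α) where
    private
      y = x + α

      x≤y : x ≤ y
      x≤y = ≤-trans (≤-reflexive (sym (+-identityʳ x))) (+-monoʳ-≤ x α≥0)

      y≥0 : 0ℚ ≤ y
      y≥0 = ≤-trans x≥0 x≤y

    -- Multiplied by k + 2, the inductive step is y T_{k+1}(y) ≤ x T_{k+1}(x) + (k + 2) α T_{k+1}(y);
    -- split y = x + α and bound x T_{k+1}(y) by x times the induction hypothesis.
    expTerm-increment : ∀ j → expTerm y (suc j) ≤ expTerm x (suc j) + α * expTerm y j
    expTerm-increment zero = ≤-reflexive
      (solve 2 (λ x α → con 1ℚ :* (x :+ α) :* con 1ℚ := con 1ℚ :* x :* con 1ℚ :+ α :* con 1ℚ) refl x α)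
      where open ℚ-Solver
    expTerm-increment (suc k) = *-cancelʳ-≤-pos m {{normalize-pos (suc (suc k)) 1}} (begin
      T y (suc (suc k)) * m
        ≡⟨ expTerm-suc y (suc k) ⟩
      t * y
        ≡⟨ solve 3 (λ t x α → t :* (x :+ α) := t :* x :+ α :* t) refl t x α ⟩
      t * x + α * t
        ≤⟨ +-monoˡ-≤ (α * t) (*-monoʳ-≤-nonNeg x {{nonNegative x≥0}} (expTerm-increment k)) ⟩
      (r + α * t₀) * x + α * t
        ≡⟨ solve 5 (λ r α t₀ x t → (r :+ α :* t₀) :* x :+ α :* t := r :* x :+ α :* (t₀ :* x) :+ α :* t)
                   refl r α t₀ x t ⟩
      r * x + α * (t₀ * x) + α * t
        ≤⟨ +-monoˡ-≤ (α * t) (+-monoʳ-≤ (r * x) (*-monoˡ-≤-nonNeg α {{nonNegative α≥0}} t₀x≤t₀y)) ⟩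
      r * x + α * (t₀ * y) + α * t
        ≡⟨ cong (λ z → r * x + α * z + α * t) (expTerm-suc y k) ⟨
      r * x + α * (t * fromℕ (suc k)) + α * t
        ≡⟨ solve 4 (λ s α t i → s :+ α :* (t :* i) :+ α :* t := s :+ α :* t :* (con 1ℚ :+ i))
                   refl (r * x) α t (fromℕ (suc k)) ⟩
      r * x + α * t * (1ℚ + fromℕ (suc k))
        ≡⟨ cong₂ (λ s i → s + α * t * i) (expTerm-suc x (suc k)) (+-distrib-/ 1 (suc k) 0) ⟨
      T x (suc (suc k)) * m + α * t * m
        ≡⟨ *-distribʳ-+ m (T x (suc (suc k))) (α * t) ⟨
      (T x (suc (suc k)) + α * t) * m ∎)
      where
      open ≤-Reasoning
      open ℚ-Solver
      T : ℚ → ℕ → ℚ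
      T = expTerm
      m = fromℕ (suc (suc k))
      t₀ = T y k
      t = T y (suc k)
      r = T x (suc k)
      t₀x≤t₀y : t₀ * x ≤ t₀ * y
      t₀x≤t₀y = *-monoˡ-≤-nonNeg t₀ {{nonNegative (expTerm-nonNeg y≥0 k)}} x≤y

    -- Eₙ(x + α) − Eₙ(x) ≤ α Eₙ₋₁(x + α), the discrete form of exp′ = exp.
    expPartial-increment : ∀ n → expPartial y n + α * expTerm y n ≤ expPartial x n + α * expPartial y n
    expPartial-increment zero    = ≤-refl
    expPartial-increment (suc n) = begin
      (E y n + T y (suc n)) + α * T y (suc n)
        ≤⟨ +-monoˡ-≤ (α * T y (suc n)) (+-monoʳ-≤ (E y n) (expTerm-increment n)) ⟩
      (E y n + (T x (suc n) + α * T y n)) + α * T y (suc n)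
        ≡⟨ solve 5 (λ e s α t u → (e :+ (s :+ α :* t)) :+ α :* u := (e :+ α :* t) :+ s :+ α :* u)
                   refl (E y n) (T x (suc n)) α (T y n) (T y (suc n)) ⟩
      (E y n + α * T y n) + T x (suc n) + α * T y (suc n)
        ≤⟨ +-monoˡ-≤ (α * T y (suc n)) (+-monoˡ-≤ (T x (suc n)) (expPartial-increment n)) ⟩
      (E x n + α * E y n) + T x (suc n) + α * T y (suc n)
        ≡⟨ solve 5 (λ e α f s u → (e :+ α :* f) :+ s :+ α :* u := (e :+ s) :+ α :* (f :+ u))
                   refl (E x n) α (E y n) (T x (suc n)) (T y (suc n)) ⟩
      (E x n + T x (suc n)) + α * (E y n + T y (suc n)) ∎
      where
      open ≤-Reasoning
      open ℚ-Solver
      T E : ℚ → ℕ → ℚ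
      T = expTerm
      E = expPartial

    expPartial-shift : ∀ n → (1ℚ - α) * expPartial y n ≤ expPartial x n
    expPartial-shift n = begin
      (1ℚ - α) * E y
        ≡⟨ solve 2 (λ e α → (con 1ℚ :- α) :* e := (e :+ con 0ℚ) :- α :* e) refl (E y) α ⟩
      (E y + 0ℚ) - α * E y
        ≤⟨ +-monoˡ-≤ (- (α * E y)) (+-monoʳ-≤ (E y) (*-nonNeg α≥0 (expTerm-nonNeg y≥0 n))) ⟩
      (E y + α * expTerm y n) - α * E y
        ≤⟨ +-monoˡ-≤ (- (α * E y)) (expPartial-increment n) ⟩
      (E x + α * E y) - α * E y
        ≡⟨ solve 2 (λ e f → (e :+ f) :- f := e) refl (E x) (α * E y) ⟩
      E x ∎
      where
      open ≤-Reasoning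
      open ℚ-Solver
      E : ℚ → ℚ
      E q = expPartial q n

  fromℕ-decay : ∀ {u v} d a → suc d ℕ.* v ℕ.+ u ℕ.* a ℕ.≤ suc d ℕ.* u →
                fromℕ v ≤ (1ℚ - + a / suc d) * fromℕ u
  fromℕ-decay {u} {v} d a sv+ua≤su = *-cancelˡ-≤-pos s {{normalize-pos (suc d) 1}} (begin
    s * fromℕ v
      ≡⟨ solve 3 (λ s v w → s :* v := (s :* v :+ w) :- w) refl s (fromℕ v) (fromℕ u * (α * s)) ⟩
    (s * fromℕ v + fromℕ u * (α * s)) - fromℕ u * (α * s)
      ≤⟨ +-monoˡ-≤ (- (fromℕ u * (α * s))) cast ⟩
    s * fromℕ u - fromℕ u * (α * s)
      ≡⟨ solve 3 (λ s u α → s :* u :- u :* (α :* s) := s :* ((con 1ℚ :- α) :* u)) refl s (fromℕ u) α ⟩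
    s * ((1ℚ - α) * fromℕ u) ∎)
    where
    open ≤-Reasoning
    open ℚ-Solver
    s = fromℕ (suc d)
    α = + a / suc d
    cast : s * fromℕ v + fromℕ u * (α * s) ≤ s * fromℕ u
    cast = begin
      s * fromℕ v + fromℕ u * (α * s)
        ≡⟨ cong₂ _+_ (fromℕ-homo-* (suc d) v) (trans (fromℕ-homo-* u a) (cong (fromℕ u *_) (sym (n/s*s≡n a d)))) ⟨
      fromℕ (suc d ℕ.* v) + fromℕ (u ℕ.* a)
        ≡⟨ +-distrib-/ (suc d ℕ.* v) (u ℕ.* a) 0 ⟨
      fromℕ (suc d ℕ.* v ℕ.+ u ℕ.* a)
        ≤⟨ fromℕ-mono-≤ sv+ua≤su ⟩
      fromℕ (suc d ℕ.* u)
        ≡⟨ fromℕ-homo-* (suc d) u ⟩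
      s * fromℕ u ∎

  LeLn-zero : ∀ d {M u} → u ℕ.≤ M → LeLn (+ 0 / suc d) M u
  LeLn-zero d {M} {u} u≤M n = begin
    expPartial (+ 0 / suc d) n * fromℕ u  ≡⟨ cong (λ q → expPartial q n * fromℕ u) (0/s≡0ℚ d) ⟩
    expPartial 0ℚ n * fromℕ u             ≡⟨ cong (_* fromℕ u) (expPartial-0ℚ n) ⟩
    1ℚ * fromℕ u                          ≡⟨ *-identityˡ (fromℕ u) ⟩
    fromℕ u                               ≤⟨ fromℕ-mono-≤ u≤M ⟩
    fromℕ M                               ∎
    where open ≤-Reasoning

  LeLn-suc : ∀ M d a i {u v} → suc d ℕ.* v ℕ.+ u ℕ.* a ℕ.≤ suc d ℕ.* u →
             LeLn (+ (i ℕ.* a) / suc d) M u → LeLn (+ (suc i ℕ.* a) / suc d) M v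
  LeLn-suc M d a i {u} {v} sv+ua≤su iα≤ln n = begin
    E (+ (a ℕ.+ i ℕ.* a) / suc d) * fromℕ v
      ≡⟨ cong (λ q → E q * fromℕ v) (trans (+-distrib-/ a (i ℕ.* a) d) (+-comm α x)) ⟩
    E (x + α) * fromℕ v
      ≤⟨ *-monoˡ-≤-nonNeg (E (x + α)) {{nonNegative (expPartial-nonNeg (+-mono-≤ x≥0 α≥0) n)}}
                          (fromℕ-decay d a sv+ua≤su) ⟩
    E (x + α) * ((1ℚ - α) * fromℕ u)
      ≡⟨ solve 3 (λ e β w → e :* (β :* w) := β :* e :* w) refl (E (x + α)) (1ℚ - α) (fromℕ u) ⟩
    (1ℚ - α) * E (x + α) * fromℕ u
      ≤⟨ *-monoʳ-≤-nonNeg (fromℕ u) {{nonNegative (/-nonNeg u 0)}} (expPartial-shift x≥0 α≥0 n) ⟩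
    E x * fromℕ u
      ≤⟨ iα≤ln n ⟩
    fromℕ M ∎
    where
    open ≤-Reasoning
    open ℚ-Solver
    x = + (i ℕ.* a) / suc d
    α = + a / suc d
    x≥0 = /-nonNeg (i ℕ.* a) d
    α≥0 = /-nonNeg a d
    E : ℚ → ℚ
    E q = expPartial q n

  LeLn-antitone : ∀ k d M {u v} → v ℕ.≤ u → LeLn (+ k / suc d) M u → LeLn (+ k / suc d) M v
  LeLn-antitone k d M v≤u q≤ln n = ≤-trans (*-monoˡ-≤-nonNeg E {{E≥0}} (fromℕ-mono-≤ v≤u)) (q≤ln n)
    where
    E = expPartial (+ k / suc d) n
    E≥0 = nonNegative (expPartial-nonNeg (/-nonNeg k d) n)

open import Data.Nat.Base using (_+_; _*_; _∸_; _≤_; _<_; z≤n; s≤s; NonZero)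

𝟙 : Bool → ℕ
𝟙 true  = 1
𝟙 false = 0

𝟙-∧ : ∀ b c → 𝟙 (b ∧ c) ≡ 𝟙 b * 𝟙 c
𝟙-∧ true  c = sym (ℕ.+-identityʳ (𝟙 c))
𝟙-∧ false c = refl

count : ∀ {n} → (Fin n → Bool) → ℕ
count p = sum (𝟙 ∘ p)

∣p∣≡count : ∀ {n} (p : Subset n) → ∣ p ∣ ≡ count (lookup p)
∣p∣≡count []            = refl
∣p∣≡count (inside  ∷ p) = cong suc (∣p∣≡count p)
∣p∣≡count (outside ∷ p) = ∣p∣≡count p

∣p∪q∣≤∣p∣+∣q∣ : ∀ {n} (p q : Subset n) → ∣ p ∪ q ∣ ≤ ∣ p ∣ + ∣ q ∣
∣p∪q∣≤∣p∣+∣q∣ []            []            = z≤n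
∣p∪q∣≤∣p∣+∣q∣ (outside ∷ p) (outside ∷ q) = ∣p∪q∣≤∣p∣+∣q∣ p q
∣p∪q∣≤∣p∣+∣q∣ (inside  ∷ p) (outside ∷ q) = s≤s (∣p∪q∣≤∣p∣+∣q∣ p q)
∣p∪q∣≤∣p∣+∣q∣ (outside ∷ p) (inside  ∷ q) =
  ℕ.≤-trans (s≤s (∣p∪q∣≤∣p∣+∣q∣ p q)) (ℕ.≤-reflexive (sym (ℕ.+-suc ∣ p ∣ ∣ q ∣)))
∣p∪q∣≤∣p∣+∣q∣ (inside  ∷ p) (inside  ∷ q) =
  s≤s (ℕ.≤-trans (∣p∪q∣≤∣p∣+∣q∣ p q) (ℕ.+-monoʳ-≤ ∣ p ∣ (ℕ.n≤1+n ∣ q ∣)))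

∈-tabulate⁺ : ∀ {n} {f : Fin n → Bool} {x} → f x ≡ true → x ∈ tabulate f
∈-tabulate⁺ {f = f} {x} fx≡true = lookup⇒[]= x (tabulate f) (trans (lookup∘tabulate f x) fx≡true)

∈-tabulate⁻ : ∀ {n} {f : Fin n → Bool} {x} → x ∈ tabulate f → f x ≡ true
∈-tabulate⁻ {f = f} {x} x∈ = trans (sym (lookup∘tabulate f x)) ([]=⇒lookup x∈)

∈-tabulate-isYes⁺ : ∀ {n} {P : Fin n → Set} (P? : ∀ x → Dec (P x)) {x} → P x → x ∈ tabulate (λ x → ⌊ P? x ⌋)
∈-tabulate-isYes⁺ P? {x} px = ∈-tabulate⁺ (trans (isYes≗does (P? x)) (dec-true (P? x) px))

sum-mono-≤ : ∀ {n} {f g : Fin n → ℕ} → (∀ i → f i ≤ g i) → sum f ≤ sum g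
sum-mono-≤ {zero}  f≤g = z≤n
sum-mono-≤ {suc n} f≤g = ℕ.+-mono-≤ (f≤g zero) (sum-mono-≤ (f≤g ∘ suc))

sum≤n*c : ∀ {n c} {f : Fin n → ℕ} → (∀ i → f i ≤ c) → sum f ≤ n * c
sum≤n*c {zero}  f≤c = z≤n
sum≤n*c {suc n} f≤c = ℕ.+-mono-≤ (f≤c zero) (sum≤n*c (f≤c ∘ suc))

count≤n : ∀ {n} (p : Fin n → Bool) → count p ≤ n
count≤n {n} p = ℕ.≤-trans (sum≤n*c (𝟙≤1 ∘ p)) (ℕ.≤-reflexive (ℕ.*-identityʳ n))
  where
  𝟙≤1 : ∀ b → 𝟙 b ≤ 1
  𝟙≤1 true  = s≤s z≤n
  𝟙≤1 false = z≤n

count-∧-not+count-∧ : ∀ {n} (p q : Fin n → Bool) →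
                      count (λ i → p i ∧ not (q i)) + count (λ i → p i ∧ q i) ≡ count p
count-∧-not+count-∧ p q =
  trans (sym (∑-distrib-+ (λ i → 𝟙 (p i ∧ not (q i))) (λ i → 𝟙 (p i ∧ q i))))
        (sum-cong-≗ (λ i → split (p i) (q i)))
  where
  split : ∀ b c → 𝟙 (b ∧ not c) + 𝟙 (b ∧ c) ≡ 𝟙 b
  split true  true  = refl
  split true  false = refl
  split false c     = refl

count<count⇒∃ : ∀ {n} (p q : Fin n → Bool) → count q < count p → ∃ λ i → p i ≡ true × q i ≡ false
count<count⇒∃ p q q<p with any? (λ i → (p i Bool.≟ true) ×-dec (q i Bool.≟ false))
... | yes found = found
... | no  none  = ⊥-elim (ℕ.<⇒≱ q<p (sum-mono-≤ (λ i → 𝟙-mono (p i) (q i) (λ pᵢ qᵢ → none (i , pᵢ , qᵢ)))))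
  where
  𝟙-mono : ∀ b c → (b ≡ true → c ≡ false → ⊥) → 𝟙 b ≤ 𝟙 c
  𝟙-mono true  true  _ = s≤s z≤n
  𝟙-mono true  false h = ⊥-elim (h refl refl)
  𝟙-mono false c     _ = z≤n

∃-argmax : ∀ {n} (f : Fin n → ℕ) → Fin n → ∃ λ i → ∀ j → f j ≤ f i
∃-argmax {n} f i₀ = i , λ j → All.lookup (Extrema.f[xs]≤f[argmax] i₀ (allFin n)) (∈-allFin j)
  where i = Extrema.argmax f i₀ (allFin n)

module _ {N : ℕ} (G : FinAbGroup N) where
  private
    abelianGroup : AbelianGroup _ _
    abelianGroup = record { isAbelianGroup = FinAbGroup.isAbelianGroup G }

  open AbelianGroup abelianGroup using (_∙_; ε; _⁻¹; _-_; assoc)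
  open import Algebra.Properties.AbelianGroup abelianGroup
    using (\\-leftDividesˡ; \\-leftDividesʳ; //-rightDividesˡ; ⁻¹-∙-comm)
  open import Algebra.Properties.CommutativeSemigroup (AbelianGroup.commutativeSemigroup abelianGroup)
    using (xy∙z≈xz∙y)

  sum-translate : ∀ (f : Fin N → ℕ) g → sum (λ h → f (g ∙ h)) ≡ sum f
  sum-translate f g = sym (∑-permute f (permutation (g ∙_) (g ⁻¹ ∙_) (\\-leftDividesˡ g) (\\-leftDividesʳ g)))

  count-translate : ∀ (p : Fin N → Bool) g → count (λ h → p (g ∙ h)) ≡ count p
  count-translate p = sum-translate (𝟙 ∘ p)

  ∣p∣≡count-translate : ∀ (p : Subset N) g → ∣ p ∣ ≡ count (λ h → lookup p (g ∙ h))
  ∣p∣≡count-translate p g = trans (∣p∣≡count p) (sym (count-translate (lookup p) g))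

  ∑-count-∧-translate : ∀ (p q : Fin N → Bool) → sum (λ y → count (λ h → p h ∧ q (h ∙ y))) ≡ count p * count q
  ∑-count-∧-translate p q = begin
    sum (λ y → sum (λ h → 𝟙 (p h ∧ q (h ∙ y))))  ≡⟨ ∑-comm (λ y h → 𝟙 (p h ∧ q (h ∙ y))) ⟩
    sum (λ h → sum (λ y → 𝟙 (p h ∧ q (h ∙ y))))  ≡⟨ sum-cong-≗ row ⟩
    sum (λ h → 𝟙 (p h) * count q)                ≡⟨ *-distribʳ-sum (count q) (𝟙 ∘ p) ⟨
    count p * count q                            ∎
    where
    open ≡-Reasoning
    row : ∀ h → sum (λ y → 𝟙 (p h ∧ q (h ∙ y))) ≡ 𝟙 (p h) * count q
    row h = begin
      sum (λ y → 𝟙 (p h ∧ q (h ∙ y)))      ≡⟨ sum-cong-≗ (λ y → 𝟙-∧ (p h) (q (h ∙ y))) ⟩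
      sum (λ y → 𝟙 (p h) * 𝟙 (q (h ∙ y)))  ≡⟨ *-distribˡ-sum (𝟙 (p h)) (λ y → 𝟙 (q (h ∙ y))) ⟨
      𝟙 (p h) * count (λ y → q (h ∙ y))    ≡⟨ cong (𝟙 (p h) *_) (count-translate q h) ⟩
      𝟙 (p h) * count q                    ∎

  [g∙h]-[h∙y]∙y≡g : ∀ g h y → ((g ∙ h) - (h ∙ y)) ∙ y ≡ g
  [g∙h]-[h∙y]∙y≡g g h y = begin
    ((g ∙ h) - (h ∙ y)) ∙ y          ≡⟨ cong (λ z → ((g ∙ h) ∙ z) ∙ y) (⁻¹-∙-comm h y) ⟨
    ((g ∙ h) ∙ (h ⁻¹ ∙ y ⁻¹)) ∙ y    ≡⟨ cong (_∙ y) (assoc g h (h ⁻¹ ∙ y ⁻¹)) ⟩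
    (g ∙ (h ∙ (h ⁻¹ ∙ y ⁻¹))) ∙ y    ≡⟨ cong (λ z → (g ∙ z) ∙ y) (\\-leftDividesˡ h (y ⁻¹)) ⟩
    (g - y) ∙ y                      ≡⟨ //-rightDividesˡ y g ⟩
    g                                ∎
    where open ≡-Reasoning

  ∈-inter⁻ : ∀ {k S x} (xs : Vec (Fin N) k) → x ∈ inter G S xs → ∀ i → x - lookup xs i ∈ S
  ∈-inter⁻ {S = S} (y ∷ xs) x∈ zero    =
    lookup⇒[]= _ S (∈-tabulate⁻ (proj₁ (x∈p∩q⁻ (shift G S y) (inter G S xs) x∈)))
  ∈-inter⁻ {S = S} (y ∷ xs) x∈ (suc i) = ∈-inter⁻ xs (proj₂ (x∈p∩q⁻ (shift G S y) (inter G S xs) x∈)) i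

  ∈-inter⁺ : ∀ {k S x} (xs : Vec (Fin N) k) → (∀ i → x - lookup xs i ∈ S) → x ∈ inter G S xs
  ∈-inter⁺ []       _  = ∈⊤
  ∈-inter⁺ (y ∷ xs) x∈ = x∈p∩q⁺ (∈-tabulate⁺ ([]=⇒lookup (x∈ zero)) , ∈-inter⁺ xs (x∈ ∘ suc))

  ∈-diffSet⁺ : ∀ {A a b} → a ∈ A → b ∈ A → a - b ∈ diffSet G A
  ∈-diffSet⁺ {A} {a} {b} a∈A b∈A = ∈-tabulate-isYes⁺ _ witness
    where
    witness : ∃ λ a′ → ∃ λ b′ → a′ ∈ A × b′ ∈ A × a - b ≡ a′ - b′
    witness = a , b , a∈A , b∈A , refl

  inter-diff : ∀ {k A} (xs : Vec (Fin N) k) {b a} →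
               b ∈ inter G A xs → a ∈ A → b - a ∈ inter G (diffSet G A) xs
  inter-diff {A = A} xs {b} {a} b∈ a∈A = ∈-inter⁺ xs λ i →
    subst (_∈ diffSet G A) (xy∙z≈xz∙y b (lookup xs i ⁻¹) (a ⁻¹)) (∈-diffSet⁺ (∈-inter⁻ xs b∈ i) a∈A)

  covers⇒0<∣Y∣ : ∀ {S Y} → Covers G S Y → 0 < ∣ Y ∣
  covers⇒0<∣Y∣ S+Y≡G with _ , _ , y , y∈Y , _ ← S+Y≡G ε = ℕ.≤-trans (s≤s z≤n) (x∈p⇒∣p-x∣<∣p∣ y∈Y)

  record PartialCover (A : Subset N) : Set where
    field
      translates : Subset N
      uncovered  : Fin N → Bool
      covered    : ∀ h → uncovered h ≡ false → ∃ λ y → y ∈ translates × h ∙ y ∈ A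

  module _ {A : Subset N} where
    open PartialCover

    nothingCovered : PartialCover A
    nothingCovered = record { translates = ∅ ; uncovered = λ _ → true ; covered = λ _ () }

    extend : PartialCover A → Fin N → PartialCover A
    extend P y = record
      { translates = ⁅ y ⁆ ∪ translates P
      ; uncovered  = λ h → uncovered P h ∧ not (lookup A (h ∙ y))
      ; covered    = extend-covered
      }
      where
      extend-covered : ∀ h → uncovered P h ∧ not (lookup A (h ∙ y)) ≡ false →
                       ∃ λ z → z ∈ ⁅ y ⁆ ∪ translates P × h ∙ z ∈ A
      extend-covered h _ with uncovered P h in h-unc | lookup A (h ∙ y) in h∙y∈A
      extend-covered h _  | false | _    = let z , z∈ , h∙z∈A = covered P h h-unc in
                                           z , x∈p∪q⁺ (inj₂ z∈) , h∙z∈A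
      extend-covered h _  | true  | true = y , x∈p∪q⁺ (inj₁ (x∈⁅x⁆ y)) , lookup⇒[]= (h ∙ y) A h∙y∈A
      extend-covered h () | true  | false

    newlyCovered : PartialCover A → Fin N → ℕ
    newlyCovered P y = count (λ h → uncovered P h ∧ lookup A (h ∙ y))

    ∣translates-extend∣ : ∀ P y → ∣ translates (extend P y) ∣ ≤ suc ∣ translates P ∣
    ∣translates-extend∣ P y = ℕ.≤-trans (∣p∪q∣≤∣p∣+∣q∣ ⁅ y ⁆ (translates P))
                                        (ℕ.≤-reflexive (cong (_+ ∣ translates P ∣) (∣⁅x⁆∣≡1 y)))

    ∑-newlyCovered : ∀ P → sum (newlyCovered P) ≡ count (uncovered P) * ∣ A ∣
    ∑-newlyCovered P = trans (∑-count-∧-translate (uncovered P) (lookup A))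
                             (cong (count (uncovered P) *_) (sym (∣p∣≡count A)))

    greedy-step : ∀ P → ∃ λ y →
                  N * count (uncovered (extend P y)) + count (uncovered P) * ∣ A ∣ ≤ N * count (uncovered P)
    greedy-step P = y , (begin
      N * u′ + u * ∣ A ∣               ≡⟨ cong (_+_ (N * u′)) (∑-newlyCovered P) ⟨
      N * u′ + sum (newlyCovered P)   ≤⟨ ℕ.+-monoʳ-≤ (N * u′) (sum≤n*c maximal) ⟩
      N * u′ + N * newlyCovered P y   ≡⟨ ℕ.*-distribˡ-+ N u′ (newlyCovered P y) ⟨
      N * (u′ + newlyCovered P y)     ≡⟨ cong (N *_) (count-∧-not+count-∧ (uncovered P) (λ h → lookup A (h ∙ y))) ⟩
      N * u                           ∎)
      where
      open ℕ.≤-Reasoning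
      y = proj₁ (∃-argmax (newlyCovered P) ε)
      maximal = proj₂ (∃-argmax (newlyCovered P) ε)
      u = count (uncovered P)
      u′ = count (uncovered (extend P y))

    covers-if-few-uncovered : ∀ {S B} → (∀ {b a} → b ∈ B → a ∈ A → b - a ∈ S) →
                              (P : PartialCover A) → count (uncovered P) < ∣ B ∣ → Covers G S (translates P)
    covers-if-few-uncovered {S} {B} B-A⊆S P u<∣B∣ g
      with h , g∙h∈B , h-unc ← count<count⇒∃ (λ h → lookup B (g ∙ h)) (uncovered P)
                                 (subst (count (uncovered P) <_) (∣p∣≡count-translate B g) u<∣B∣)
      with y , y∈Y , h∙y∈A ← covered P h h-unc
      = (g ∙ h) - (h ∙ y) , B-A⊆S (lookup⇒[]= (g ∙ h) B g∙h∈B) h∙y∈A , y , y∈Y , sym ([g∙h]-[h∙y]∙y≡g g h y)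

module _ {d : ℕ} (G : FinAbGroup (suc d)) (A : Subset (suc d)) where
  open PartialCover

  -- The invariant is |U| ≤ e^{−iα} N, a relaxation of |U| ≤ (1 − α)^i N.
  greedy-cover : ∀ i → Σ (PartialCover G A) λ P →
                 ∣ translates P ∣ ≤ i × LeLn (+ (i * ∣ A ∣) / suc d) (suc d) (count (uncovered P))
  greedy-cover zero =
    nothingCovered G , ℕ.≤-reflexive (∣⊥∣≡0 (suc d)) , LeLn-zero d (count≤n {suc d} (λ _ → true))
  greedy-cover (suc i) =
    let P , ∣Y∣≤i , iα≤ln = greedy-cover i
        y , shrink        = greedy-step G P
    in extend G P y , ℕ.≤-trans (∣translates-extend∣ G P y) (s≤s ∣Y∣≤i) , LeLn-suc (suc d) d ∣ A ∣ i shrink iα≤ln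

-- The greedy argument works for every X.
corollary24 : (N : ℕ) → .{{_ : NonZero N}} → (G : FinAbGroup N) →
    (k : ℕ) → 1 ≤ k → (A : Subset N) → 0 < ∣ A ∣ →
    (xs : Vec (Fin N) k) → InDiffDiag G A xs →
    0 < ∣ inter G A xs ∣ →
    (c : ℕ) → IsCov G (inter G (diffSet G A) xs) c →
    CovBound c (∣ A ∣) N (∣ inter G A xs ∣)
corollary24 (suc d) G _ _ A _ xs _ _ c ((_ , Y₀-covers , ∣Y₀∣≡c) , minimal) =
  let P , ∣Y∣≤c∸1 , bound = greedy-cover G A (c ∸ 1) in
  LeLn-antitone ((c ∸ 1) * ∣ A ∣) d (suc d) (∣B∣≤uncovered P ∣Y∣≤c∸1) bound
  where
  open PartialCover

  c∸1<c : c ∸ 1 < c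
  c∸1<c = ℕ.∸-monoʳ-< (s≤s z≤n) (subst (1 ≤_) ∣Y₀∣≡c (covers⇒0<∣Y∣ G Y₀-covers))

  ∣B∣≤uncovered : ∀ P → ∣ translates P ∣ ≤ c ∸ 1 → ∣ inter G A xs ∣ ≤ count (uncovered P)
  ∣B∣≤uncovered P ∣Y∣≤c∸1 = ℕ.≮⇒≥ λ u<∣B∣ →
    let c≤∣Y∣ = minimal (translates P) (covers-if-few-uncovered G (inter-diff G xs) P u<∣B∣)
    in ℕ.<-irrefl refl (ℕ.≤-<-trans (ℕ.≤-trans c≤∣Y∣ ∣Y∣≤c∸1) c∸1<c)
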